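{- (1) For any class $C$: if every broad rubric on $C$ generates a set, then every rubric on $C$ generates a set. (2) Broad Set Generation implies Broad Infinity and Reduced Broad Infinity. (3) Broad Family Generation implies Broad Infinity and Reduced Broad Infinity.
   Context: Ambient theory ("Base Theory"): intuitionistic first-order set theory with equality, predicates $\mathrm{isSet}$ and $\in$, urelements allowed, no Foundation; axioms Extensionality, Inhabitation (anything with an element is a set), Empty Set, Pairing, Union, Replacement, Truth Value Separation (for each formula $\psi$, $\{x\mid x=\emptyset\wedge\psi\}$ is a set), Infinity, Exponentiation. No Excluded Middle, Choice or Powerset. $\mathfrak T$ = class of all things, $\mathfrak S$ = class of all sets. Statements about schemes are schematic (classes and class functions are given by formulas). A family within a class $C$ is a set $J$ with a function $J\to C$, written $(b_j)_{j\in J}$; a $K$-tuple within $C$ is a function $K\to C$, written $[a_k]_{k\in K}$. A rule $\langle K,R\rangle$ on $C$ is a set $K$ and a class function $R$ sending each $K$-tuple within $C$ to a family within $C$. A rubric on $C$ is a family of rules $\mathcal R=(\langle K_i,R_i\rangle)_{i\in I}$. A subset $X\subseteq C$ is $\mathcal R$-inductive if for all $i\in I$, every $K_i$-tuple $[a_k]$ within $X$ with $R_i[a_k]_{k\in K_i}=(y_p)_{p\in P}$, and every $p\in P$, we have $y_p\in X$. A broad rubric $\mathcal B$ on $C$ consists of a rubric $\mathcal B_0$ on $C$ and a class function $\mathcal B_1$ assigning to each $x\in C$ a rubric $\mathcal B_1(x)$ on $C$; $X\subseteq C$ is $\mathcal B$-inductive if it is $\mathcal B_0$-inductive and $\mathcal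 B_1(x)$-inductive for every $x\in X$. A (broad) rubric generates a set if there is a least inductive subset of $C$. Broad Set Generation: every broad rubric on $\mathfrak T$ generates a set. Families within $C$ are ordered by inclusion: $(y_n)_{n\in N}\le(x_m)_{m\in M}$ iff $N\subseteq M$ and $y_n=x_n$ for all $n\in N$. Let $\mathrm{Basic}(i,g,p)=\langle0,\langle i,g,p\rangle\rangle$ and $\mathrm{Trigger}(m,i,g,p)=\langle1,\langle m,i,g,p\rangle\rangle$. For a broad rubric $\mathcal B$ on $C$, a family $(x_m)_{m\in M}$ within $C$ is $\mathcal B$-inductive if (a) writing $\mathcal B_0=(\langle K_i,R_i\rangle)_{i\in I}$, for every $i\in I$, $g:K_i\to M$ with $R_i[x_{g(k)}]_{k\in K_i}=(y_p)_{p\in P}$, and $p\in P$, we have $\mathrm{Basic}(i,g,p)\in M$ and $x_{\mathrm{Basic}(i,g,p)}=y_p$; and (b) for every $m\in M$, writing $\mathcal B_1(x_m)=(\langle K_i,R_i\rangle)_{i\in I}$, for every $i\in I$, $g:K_i\to M$ with $R_i[x_{g(k)}]_{k\in K_i}=(y_p)_{p\in P}$, and $p\in P$, we have $\mathrm{Trigger}(m,i,g,p)\in M$ and $x_{\mathrm{Trigger}(m,i,g,p)}=y_p$. $\mathcal B$ generates a family if there is a least $\mathcal B$-inductive family. Broad Family Generation: every broad rubric on $\mathfrak T$ generates a family. A signature is a family of sets $(K_i)_{i\in I}$. A broad signature $G$ assigns (via a class function) a signature $Gx$ to every thing $x$. Let $\mathrm{Start}=\emptyset$, $\mathrm{Build}(x,y,z)=\{\{x\},\{x,\{\{y\},\{y,z\}\}\}\}$.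 A set $X$ is $G$-inductive if $\mathrm{Start}\in X$ and for each $x\in X$ with $Gx=(K_i)_{i\in I}$, each $i\in I$ and each $K_i$-tuple $[a_k]$ within $X$, $\mathrm{Build}(x,i,[a_k]_{k\in K_i})\in X$. Broad Infinity: for every broad signature $G$ there is a least $G$-inductive set. A reduced broad signature is a class function $F:\mathfrak T\to\mathfrak S$. Let $\mathrm{Begin}=\emptyset$, $\mathrm{Make}(x,y)=\{\{x\},\{x,y\}\}$. A set $X$ is $F$-inductive if $\mathrm{Begin}\in X$ and for every $x\in X$ and $F(x)$-tuple $[a_k]$ within $X$, $\mathrm{Make}(x,[a_k]_{k\in F(x)})\in X$. Reduced Broad Infinity: every reduced broad signature $F$ has a least $F$-inductive set. -}

module Defs where

open import Data.Product using (Σ; _×_; _,_; proj₁)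
open import Data.Sum using (_⊎_)
open import Data.Unit using (⊤; tt)
open import Relation.Nullary using (¬_)
open import Relation.Binary.PropositionalEquality using (_≡_)
open import Function.Bundles using (_⇔_)

-- A model of the Base Theory (intuitionistic first-order set theory with
-- urelements).  Things form the type T; formulas are Agda types; axiom
-- schemes quantify over Agda predicates/relations.
record BaseSig : Set₁ where
  field
    T     : Set
    isSet : T → Set
    _∈_   : T → T → Set
    extensionality : ∀ {x y} → isSet x → isSet y →
      (∀ z → (z ∈ x) ⇔ (z ∈ y)) → x ≡ y
    inhabitation : ∀ {x y} → y ∈ x → isSet x
    emptySet : Σ T λ e → isSet e × (∀ z → ¬ (z ∈ e))
    pairing : ∀ x y → Σ T λ p → isSet p × (∀ z → (z ∈ p) ⇔ (z ≡ x ⊎ z ≡ y))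
    union : ∀ x → Σ T λ u → isSet u × (∀ z → (z ∈ u) ⇔ (Σ T λ y → y ∈ x × z ∈ y))
    replacement : (F : T → T → Set) → ∀ a → isSet a →
      (∀ x → x ∈ a → Σ T λ y → F x y × (∀ y' → F x y' → y' ≡ y)) →
      Σ T λ b → isSet b × (∀ y → (y ∈ b) ⇔ (Σ T λ x → x ∈ a × F x y))
    truthValueSeparation : (ψ : Set) →
      Σ T λ s → isSet s × (∀ x → (x ∈ s) ⇔ (x ≡ proj₁ emptySet × ψ))
    infinity : Σ T λ a → isSet a × proj₁ emptySet ∈ a ×
      (∀ x → x ∈ a → Σ T λ s → s ∈ a × isSet s × (∀ z → (z ∈ s) ⇔ (z ∈ x ⊎ z ≡ x)))

module SigNotions (S : BaseSig) where
  open BaseSig S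

  ∅ : T
  ∅ = proj₁ emptySet

  upair : T → T → T
  upair x y = proj₁ (pairing x y)

  sing : T → T
  sing x = upair x x

  ⟨_,_⟩ : T → T → T
  ⟨ x , y ⟩ = upair (sing x) (upair x y)

  Class : Set₁
  Class = T → Set

  IsFun : T → Class → T → Set
  IsFun A C f = isSet f
    × (∀ z → z ∈ f → Σ T λ x → Σ T λ y → z ≡ ⟨ x , y ⟩ × x ∈ A × C y)
    × (∀ x → x ∈ A → Σ T λ y → ⟨ x , y ⟩ ∈ f × (∀ y' → ⟨ x , y' ⟩ ∈ f → y' ≡ y))

  Exponentiation : Set
  Exponentiation = ∀ A B → isSet A → isSet B →
    Σ T λ E → isSet E × (∀ f → (f ∈ E) ⇔ IsFun A (_∈ B) f)

record BaseTheory : Set₁ where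
  field
    sig : BaseSig
    exponentiation : SigNotions.Exponentiation sig

module Notions (M : BaseTheory) where
  open BaseTheory M
  open BaseSig sig public
  open SigNotions sig public

  𝔗 : Class
  𝔗 _ = ⊤

  𝔖 : Class
  𝔖 = isSet

  _⊆_ : T → T → Set
  X ⊆ Y = ∀ z → z ∈ X → z ∈ Y

  _⊆ᶜ_ : T → Class → Set
  X ⊆ᶜ C = isSet X × (∀ y → y ∈ X → C y)

  IsFamily : Class → T → Set
  IsFamily C f = Σ T λ J → isSet J × IsFun J C f

  weaken : ∀ {K a} {C D : Class} → (∀ y → C y → D y) → IsFun K C a → IsFun K D a
  weaken h (s , p , q) =
    s , (λ z hz → let (x , y , e , hx , hy) = p z hz in x , y , e , hx , h y hy) , q

  record Rule (C : Class) : Set where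
    field
      K     : T
      K-set : isSet K
      R     : (a : T) → IsFun K C a → T
      R-fam : ∀ a (ha : IsFun K C a) → IsFamily C (R a ha)

  record Rubric (C : Class) : Set where
    field
      I     : T
      I-set : isSet I
      rule  : (i : T) → i ∈ I → Rule C

  RubricInductive : {C : Class} → Rubric C → (X : T) → X ⊆ᶜ C → Set
  RubricInductive 𝓡 X (_ , sub) =
    ∀ i (hi : i ∈ Rubric.I 𝓡) → let ρ = Rubric.rule 𝓡 i hi in
    ∀ a (ha : IsFun (Rule.K ρ) (_∈ X) a) →
    ∀ p y → ⟨ p , y ⟩ ∈ Rule.R ρ a (weaken sub ha) → y ∈ X

  Generates : {C : Class} → Rubric C → Set
  Generates {C} 𝓡 = Σ T λ X → Σ (X ⊆ᶜ C) λ hX → RubricInductive 𝓡 X hX ×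
    (∀ Y (hY : Y ⊆ᶜ C) → RubricInductive 𝓡 Y hY → X ⊆ Y)

  record BroadRubric (C : Class) : Set where
    field
      B₀ : Rubric C
      B₁ : (x : T) → C x → Rubric C

  BroadInductive : {C : Class} → BroadRubric C → (X : T) → X ⊆ᶜ C → Set
  BroadInductive 𝓑 X hX =
    RubricInductive (BroadRubric.B₀ 𝓑) X hX ×
    (∀ x (hx : x ∈ X) → RubricInductive (BroadRubric.B₁ 𝓑 x (proj₂' hX x hx)) X hX)
    where
    proj₂' : X ⊆ᶜ _ → ∀ y → y ∈ X → _
    proj₂' (_ , s) = s

  GeneratesB : {C : Class} → BroadRubric C → Set
  GeneratesB {C} 𝓑 = Σ T λ X → Σ (X ⊆ᶜ C) λ hX → BroadInductive 𝓑 X hX ×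
    (∀ Y (hY : Y ⊆ᶜ C) → BroadInductive 𝓑 Y hY → X ⊆ Y)

  BroadSetGeneration : Set
  BroadSetGeneration = (𝓑 : BroadRubric 𝔗) → GeneratesB 𝓑

  zero' one' : T
  zero' = ∅
  one'  = sing ∅

  Basic : T → T → T → T
  Basic i g p = ⟨ zero' , ⟨ i , ⟨ g , p ⟩ ⟩ ⟩

  Trigger : T → T → T → T → T
  Trigger m i g p = ⟨ one' , ⟨ m , ⟨ i , ⟨ g , p ⟩ ⟩ ⟩ ⟩

  FamLeq : (N y M x : T) → Set
  FamLeq N y M x = (N ⊆ M) ×
    (∀ n → n ∈ N → ∀ u v → ⟨ n , u ⟩ ∈ y → ⟨ n , v ⟩ ∈ x → u ≡ v)

  -- t is the tuple [x_{g(k)}]_k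
  IsComposite : (g x t : T) → Set
  IsComposite g x t = ∀ k m → ⟨ k , m ⟩ ∈ g → ∀ v → ⟨ k , v ⟩ ∈ t → ⟨ m , v ⟩ ∈ x

  FamRubricClause : Rubric 𝔗 → (T → T → T → T) → (M x : T) → Set
  FamRubricClause 𝓡 code M x =
    ∀ i (hi : i ∈ Rubric.I 𝓡) → let ρ = Rubric.rule 𝓡 i hi in
    ∀ g → IsFun (Rule.K ρ) (_∈ M) g →
    ∀ t (ht : IsFun (Rule.K ρ) 𝔗 t) → IsComposite g x t →
    ∀ p v → ⟨ p , v ⟩ ∈ Rule.R ρ t ht →
    code i g p ∈ M × ⟨ code i g p , v ⟩ ∈ x

  FamInductive : BroadRubric 𝔗 → (M x : T) → Set
  FamInductive 𝓑 M x =
    FamRubricClause (BroadRubric.B₀ 𝓑) Basic M x ×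
    (∀ m → m ∈ M → ∀ xm → ⟨ m , xm ⟩ ∈ x →
      FamRubricClause (BroadRubric.B₁ 𝓑 xm tt) (Trigger m) M x)

  GeneratesFamily : BroadRubric 𝔗 → Set
  GeneratesFamily 𝓑 = Σ T λ M → Σ T λ x → isSet M × IsFun M 𝔗 x × FamInductive 𝓑 M x ×
    (∀ N y → isSet N → IsFun N 𝔗 y → FamInductive 𝓑 N y → FamLeq M x N y)

  BroadFamilyGeneration : Set
  BroadFamilyGeneration = (𝓑 : BroadRubric 𝔗) → GeneratesFamily 𝓑

  IsSignature : T → Set
  IsSignature s = IsFamily 𝔖 s

  Start : T
  Start = ∅

  Build : T → T → T → T
  Build x y z = ⟨ x , ⟨ y , z ⟩ ⟩

  GInductive : (G : T → T) → T → Set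
  GInductive G X = isSet X × Start ∈ X ×
    (∀ x → x ∈ X → ∀ i Ki → ⟨ i , Ki ⟩ ∈ G x →
      ∀ a → IsFun Ki (_∈ X) a → Build x i a ∈ X)

  BroadInfinity : Set
  BroadInfinity = (G : T → T) → (∀ x → IsSignature (G x)) →
    Σ T λ X → GInductive G X × (∀ Y → GInductive G Y → X ⊆ Y)

  Begin : T
  Begin = ∅

  Make : T → T → T
  Make x y = ⟨ x , y ⟩

  FInductive : (F : T → T) → T → Set
  FInductive F X = isSet X × Begin ∈ X ×
    (∀ x → x ∈ X → ∀ a → IsFun (F x) (_∈ X) a → Make x a ∈ X)

  ReducedBroadInfinity : Set
  ReducedBroadInfinity = (F : T → T) → (∀ x → isSet (F x)) →
    Σ T λ X → FInductive F X × (∀ Y → FInductive F Y → X ⊆ Y)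

-- (1) A rubric is a broad rubric whose rules do not depend on x.
-- For (2) and (3), broad and reduced broad signatures are both instances of an abstract
-- signature, whose inductive sets are those of the broad rubric with one nullary rule yielding ∅
-- and, at each x, one rule per operation i sending a tuple a to build x i a. A generated set is
-- then the required least set. For a generated family the candidate is its image; this is closed
-- under build because the family is injective (by family induction, since build is injective and
-- never ∅), so a tuple of values pulls back to a tuple of indices by Replacement, without Choice.

module Submission where

open import Defs
open import Data.Product using (_×_; Σ; _,_; proj₁; proj₂; swap)
open import Data.Sum using (_⊎_; inj₁; inj₂; [_,_]′)
open import Data.Unit using (tt)
open import Data.Empty using (⊥-elim)
open import Function using (id; _∘_)
open import Relation.Nullary using (¬_)
open import Relation.Binary.PropositionalEquality using (_≡_; refl; sym; trans; subst; cong)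
open import Function.Bundles using (_⇔_; Equivalence; mk⇔)

module Model (𝕄 : BaseTheory) where
  open Notions 𝕄
  open Equivalence using (to; from)

  ∅-isSet : isSet ∅
  ∅-isSet = proj₁ (proj₂ emptySet)

  ∅-empty : ∀ z → ¬ (z ∈ ∅)
  ∅-empty = proj₂ (proj₂ emptySet)

  upair-isSet : ∀ a b → isSet (upair a b)
  upair-isSet a b = proj₁ (proj₂ (pairing a b))

  ∈-upair⁻ : ∀ {a b z} → z ∈ upair a b → z ≡ a ⊎ z ≡ b
  ∈-upair⁻ {a} {b} {z} = to (proj₂ (proj₂ (pairing a b)) z)

  ∈-upairˡ : ∀ a b → a ∈ upair a b
  ∈-upairˡ a b = from (proj₂ (proj₂ (pairing a b)) a) (inj₁ refl)

  ∈-upairʳ : ∀ a b → b ∈ upair a b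
  ∈-upairʳ a b = from (proj₂ (proj₂ (pairing a b)) b) (inj₂ refl)

  ∈-sing⁻ : ∀ {a z} → z ∈ sing a → z ≡ a
  ∈-sing⁻ h = [ id , id ]′ (∈-upair⁻ h)

  upair-injective : ∀ {a b c d} → upair a b ≡ upair c d → (a ≡ c × b ≡ d) ⊎ (a ≡ d × b ≡ c)
  upair-injective {a} {b} {c} {d} e
    with ∈-upair⁻ (subst (a ∈_) e (∈-upairˡ a b)) | ∈-upair⁻ (subst (b ∈_) e (∈-upairʳ a b))
  ... | inj₁ refl | inj₂ refl = inj₁ (refl , refl)
  ... | inj₂ refl | inj₁ refl = inj₂ (refl , refl)
  ... | inj₁ refl | inj₁ refl = inj₁ (refl , sym (∈-sing⁻ (subst (d ∈_) (sym e) (∈-upairʳ c d))))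
  ... | inj₂ refl | inj₂ refl = inj₁ (sym (∈-sing⁻ (subst (c ∈_) (sym e) (∈-upairˡ c d))) , refl)

  sing-injective : ∀ {a b} → sing a ≡ sing b → a ≡ b
  sing-injective e = [ proj₁ , proj₁ ]′ (upair-injective e)

  sing≡upair⁻ : ∀ {a b c} → sing a ≡ upair b c → a ≡ b × a ≡ c
  sing≡upair⁻ e = [ id , swap ]′ (upair-injective e)

  pair-injective : ∀ {a b c d} → ⟨ a , b ⟩ ≡ ⟨ c , d ⟩ → a ≡ c × b ≡ d
  pair-injective e with upair-injective e
  ... | inj₁ (sa≡sc , ab≡cd) with sing-injective sa≡sc
  ...   | refl = refl , [ proj₂ , (λ (a≡d , b≡a) → trans b≡a a≡d) ]′ (upair-injective ab≡cd)
  pair-injective e | inj₂ (sa≡cd , ab≡sc) with sing≡upair⁻ sa≡cd | sing≡upair⁻ (sym ab≡sc)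
  ... | refl , a≡d | _ , a≡b = refl , trans (sym a≡b) a≡d

  pair≢∅ : ∀ {a b} → ¬ (⟨ a , b ⟩ ≡ ∅)
  pair≢∅ {a} e = ∅-empty _ (subst (sing a ∈_) e (∈-upairˡ _ _))

  graph⁻ : ∀ {A C f k v} → IsFun A C f → ⟨ k , v ⟩ ∈ f → k ∈ A × C v
  graph⁻ (_ , graph , _) h with graph _ h
  ... | _ , _ , e , k∈A , Cv with pair-injective e
  ...   | refl , refl = k∈A , Cv

  graph-total : ∀ {A C f k} → IsFun A C f → k ∈ A → Σ T λ v → ⟨ k , v ⟩ ∈ f
  graph-total (_ , _ , total) k∈A = proj₁ (total _ k∈A) , proj₁ (proj₂ (total _ k∈A))

  graph-functional : ∀ {A C f k v v'} → IsFun A C f → ⟨ k , v ⟩ ∈ f → ⟨ k , v' ⟩ ∈ f → v ≡ v'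
  graph-functional hf@(_ , _ , total) h h' with total _ (proj₁ (graph⁻ hf h))
  ... | _ , _ , unique = trans (unique _ h) (sym (unique _ h'))

  IsFun-⊆⇒≡ : ∀ {A C C' f f'} → IsFun A C f → IsFun A C' f' → f ⊆ f' → f ≡ f'
  IsFun-⊆⇒≡ {f = f} {f'} hf@(f-set , _ , _) hf'@(f'-set , graph' , _) f⊆f' =
    extensionality f-set f'-set λ z → mk⇔ (f⊆f' z) (superset z)
    where
    superset : ∀ z → z ∈ f' → z ∈ f
    superset z z∈f' with graph' z z∈f'
    ... | k , v , refl , k∈A , _ with graph-total hf k∈A
    ...   | w , kw∈f with graph-functional hf' z∈f' (f⊆f' _ kw∈f)
    ...     | refl = kw∈f

  ∅-IsFun : ∀ {C} → IsFun ∅ C ∅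
  ∅-IsFun = ∅-isSet , (λ z h → ⊥-elim (∅-empty z h)) , (λ k h → ⊥-elim (∅-empty k h))

  IsFun-∅⇒≡∅ : ∀ {C g} → IsFun ∅ C g → g ≡ ∅
  IsFun-∅⇒≡∅ {C} hg@(_ , graph , _) = IsFun-⊆⇒≡ hg (∅-IsFun {C}) λ z z∈g →
    let (k , _ , _ , k∈∅ , _) = graph z z∈g in ⊥-elim (∅-empty k k∈∅)

  single : T → T
  single v = sing ⟨ ∅ , v ⟩

  ∈-single : ∀ v → ⟨ ∅ , v ⟩ ∈ single v
  ∈-single v = ∈-upairˡ _ _

  ∈-single⁻ : ∀ {p y v} → ⟨ p , y ⟩ ∈ single v → p ≡ ∅ × y ≡ v
  ∈-single⁻ h = pair-injective (∈-sing⁻ h)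

  single-isFamily : ∀ v → IsFamily 𝔗 (single v)
  single-isFamily v = sing ∅ , upair-isSet ∅ ∅ , upair-isSet _ _ ,
    (λ z h → ∅ , v , ∈-sing⁻ h , ∈-upairˡ ∅ ∅ , tt) ,
    (λ k k∈1 → v , subst (λ k → ⟨ k , v ⟩ ∈ single v) (sym (∈-sing⁻ k∈1)) (∈-single v) ,
       λ v' h → proj₂ (∈-single⁻ (subst (λ k → ⟨ k , v' ⟩ ∈ single v) (∈-sing⁻ k∈1) h)))

  singletonIf : ∀ a (ψ : Set) → Σ T λ s → ∀ z → (z ∈ s) ⇔ (z ≡ a × ψ)
  singletonIf a ψ with truthValueSeparation ψ
  ... | tv , tv-set , ∈tv with replacement (λ _ w → w ≡ a) tv tv-set (λ _ _ → a , refl , λ _ e → e)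
  ...   | s , _ , ∈s = s , λ z → mk⇔
          (λ z∈s → let (u , u∈tv , z≡a) = to (∈s z) z∈s in z≡a , proj₂ (to (∈tv u) u∈tv))
          (λ (z≡a , holds) → from (∈s z) (∅ , from (∈tv ∅) (refl , holds) , z≡a))

  record Separation (A : T) (φ : T → Set) : Set where
    field
      S : T
      S-set : isSet S
      ∈S⁻ : ∀ {z} → z ∈ S → z ∈ A × φ z
      ∈S : ∀ {z} → z ∈ A → φ z → z ∈ S

  -- Only truth-value separation is an axiom: {z ∈ A ∣ φ z} is the union over a ∈ A of {a ∣ φ a}.
  separation : ∀ A → isSet A → (φ : T → Set) → Separation A φ
  separation A A-set φ
    with replacement (λ a s → s ≡ proj₁ (singletonIf a (φ a))) A A-set
                     (λ _ _ → _ , refl , λ _ e → e)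
  ... | O , _ , ∈O with union O
  ...   | S , S-set , ∈S = record { S = S ; S-set = S-set ; ∈S⁻ = out ; ∈S = inn }
    where
    out : ∀ {z} → z ∈ S → z ∈ A × φ z
    out {z} z∈S with to (∈S z) z∈S
    ... | s , s∈O , z∈s with to (∈O s) s∈O
    ...   | a , a∈A , refl with to (proj₂ (singletonIf a (φ a)) z) z∈s
    ...     | refl , φa = a∈A , φa
    inn : ∀ {z} → z ∈ A → φ z → z ∈ S
    inn {z} z∈A φz = from (∈S z) (_ , from (∈O _) (z , z∈A , refl) ,
                                    from (proj₂ (singletonIf z (φ z)) z) (refl , φz))

  range : ∀ {A C f} → isSet A → IsFun A C f →
    Σ T λ X → isSet X × (∀ v → (v ∈ X) ⇔ (Σ T λ k → ⟨ k , v ⟩ ∈ f))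
  range {f = f} A-set hf@(_ , _ , total)
    with replacement (λ k v → ⟨ k , v ⟩ ∈ f) _ A-set
                     (λ k k∈A → let (v , kv , u) = total k k∈A in v , kv , u)
  ... | X , X-set , ∈X = X , X-set , λ v → mk⇔
          (λ v∈X → let (k , _ , kv) = to (∈X v) v∈X in k , kv)
          (λ (k , kv) → from (∈X v) (k , proj₁ (graph⁻ hf kv) , kv))

  composite-IsFun : ∀ {D C C' Q g f t} → IsFun D Q g → IsFun D C t → IsComposite g f t →
    (∀ {n v} → Q n → ⟨ n , v ⟩ ∈ f → C' v) → IsFun D C' t
  composite-IsFun hg (t-set , graph , total) comp transfer = t-set , graph' , total
    where
    graph' : ∀ z → z ∈ _ → _
    graph' z z∈t with graph z z∈t
    ... | k , v , refl , k∈D , _ with graph-total hg k∈D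
    ...   | n , kn∈g = k , v , refl , k∈D , transfer (proj₂ (graph⁻ hg kn∈g)) (comp k n kn∈g v z∈t)

  pullback : ∀ {A C f D a} → IsFun A C f → (∀ {m n v} → ⟨ m , v ⟩ ∈ f → ⟨ n , v ⟩ ∈ f → m ≡ n) →
    IsFun D (λ v → Σ T λ m → ⟨ m , v ⟩ ∈ f) a → Σ T λ g → IsFun D (_∈ A) g × IsComposite g f a
  pullback {A} {f = f} {D} {a} hf f-injective ha@(a-set , a-graph , _) =
    g , (proj₁ (proj₂ g-repl) , g-graph , g-total) , composite
    where
    Reindex : T → T → Set
    Reindex z w = Σ T λ k → Σ T λ v → Σ T λ n → z ≡ ⟨ k , v ⟩ × ⟨ n , v ⟩ ∈ f × w ≡ ⟨ k , n ⟩
    reindex : ∀ z → z ∈ a → Σ T λ w → Reindex z w × (∀ w' → Reindex z w' → w' ≡ w)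
    reindex z z∈a with a-graph z z∈a
    ... | k , v , refl , _ , (n , nv∈f) = ⟨ k , n ⟩ , (k , v , n , refl , nv∈f , refl) , unique
      where
      unique : ∀ w' → Reindex ⟨ k , v ⟩ w' → w' ≡ ⟨ k , n ⟩
      unique _ (_ , _ , n' , e , n'v∈f , refl) with pair-injective e
      ... | refl , refl = cong ⟨ k ,_⟩ (f-injective n'v∈f nv∈f)
    g-repl : Σ T λ g → isSet g × (∀ w → (w ∈ g) ⇔ (Σ T λ z → z ∈ a × Reindex z w))
    g-repl = replacement Reindex a a-set reindex
    g : T
    g = proj₁ g-repl
    ∈g⁻ : ∀ {k n} → ⟨ k , n ⟩ ∈ g → Σ T λ v → ⟨ k , v ⟩ ∈ a × ⟨ n , v ⟩ ∈ f
    ∈g⁻ h with to (proj₂ (proj₂ g-repl) _) h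
    ... | _ , z∈a , (_ , v , _ , refl , nv∈f , e) with pair-injective e
    ...   | refl , refl = v , z∈a , nv∈f
    g-graph : ∀ w → w ∈ g → Σ T λ k → Σ T λ n → w ≡ ⟨ k , n ⟩ × k ∈ D × n ∈ A
    g-graph w h with to (proj₂ (proj₂ g-repl) w) h
    ... | _ , z∈a , (k , v , n , refl , nv∈f , refl) =
      k , n , refl , proj₁ (graph⁻ ha z∈a) , proj₁ (graph⁻ hf nv∈f)
    g-total : ∀ k → k ∈ D → Σ T λ n → ⟨ k , n ⟩ ∈ g × (∀ n' → ⟨ k , n' ⟩ ∈ g → n' ≡ n)
    g-total k k∈D with graph-total ha k∈D
    ... | v , kv∈a with proj₂ (graph⁻ ha kv∈a)
    ...   | n , nv∈f =
      n , from (proj₂ (proj₂ g-repl) _) (_ , kv∈a , (k , v , n , refl , nv∈f , refl)) , unique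
      where
      unique : ∀ n' → ⟨ k , n' ⟩ ∈ g → n' ≡ n
      unique n' h with ∈g⁻ h
      ... | v' , kv'∈a , n'v'∈f with graph-functional ha kv∈a kv'∈a
      ...   | refl = f-injective n'v'∈f nv∈f
    composite : IsComposite g f a
    composite k n kn∈g v kv∈a with ∈g⁻ kn∈g
    ... | v' , kv'∈a , nv'∈f with graph-functional ha kv'∈a kv∈a
    ...   | refl = nv'∈f

  generatesB⇒generates : {C : Class} → ((𝓑 : BroadRubric C) → GeneratesB 𝓑) →
    (𝓡 : Rubric C) → Generates 𝓡
  generatesB⇒generates generatesB 𝓡 with generatesB (record { B₀ = 𝓡 ; B₁ = λ _ _ → 𝓡 })
  ... | X , X⊆C , (X-ind , _) , least =
    X , X⊆C , X-ind , λ Y Y⊆C Y-ind → least Y Y⊆C (Y-ind , λ _ _ → Y-ind)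

  module LeastFamily (𝓑 : BroadRubric 𝔗) (generated : GeneratesFamily 𝓑) where
    open BroadRubric 𝓑 public

    M x : T
    M = proj₁ generated
    x = proj₁ (proj₂ generated)

    M-set : isSet M
    M-set = proj₁ (proj₂ (proj₂ generated))

    x-fun : IsFun M 𝔗 x
    x-fun = proj₁ (proj₂ (proj₂ (proj₂ generated)))

    x-inductive : FamInductive 𝓑 M x
    x-inductive = proj₁ (proj₂ (proj₂ (proj₂ (proj₂ generated))))

    x-least : ∀ N y → isSet N → IsFun N 𝔗 y → FamInductive 𝓑 N y → FamLeq M x N y
    x-least = proj₂ (proj₂ (proj₂ (proj₂ (proj₂ generated))))

    StepClosed : Rubric 𝔗 → (T → T → T → T) → (T → Set) → Set
    StepClosed 𝓡 code P = ∀ i (hi : i ∈ Rubric.I 𝓡) → let ρ = Rubric.rule 𝓡 i hi in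
      ∀ g → IsFun (Rule.K ρ) (λ n → n ∈ M × P n) g →
      ∀ t (ht : IsFun (Rule.K ρ) 𝔗 t) → IsComposite g x t →
      ∀ p v → ⟨ p , v ⟩ ∈ Rule.R ρ t ht → ⟨ code i g p , v ⟩ ∈ x → P (code i g p)

    -- The indices satisfying P, with the restriction of x to them, form an inductive subfamily.
    module Restriction (P : T → Set) where
      open Separation (separation M M-set P) public
        using () renaming (S to N; S-set to N-set; ∈S⁻ to ∈N⁻; ∈S to ∈N)

      RestrictedPair : T → Set
      RestrictedPair z = Σ T λ n → Σ T λ w → z ≡ ⟨ n , w ⟩ × P n

      open Separation (separation x (proj₁ x-fun) RestrictedPair) public
        using () renaming (S to y; S-set to y-set; ∈S⁻ to ∈y⁻; ∈S to ∈y⁺)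

      y⊆x : y ⊆ x
      y⊆x _ = proj₁ ∘ ∈y⁻

      ∈y⇒P : ∀ {n w} → ⟨ n , w ⟩ ∈ y → P n
      ∈y⇒P h with proj₂ (∈y⁻ h)
      ... | _ , _ , e , Pn with pair-injective e
      ...   | refl , refl = Pn

      ∈y : ∀ {n w} → ⟨ n , w ⟩ ∈ x → P n → ⟨ n , w ⟩ ∈ y
      ∈y {n} {w} h Pn = ∈y⁺ h (n , w , refl , Pn)

      y-fun : IsFun N 𝔗 y
      y-fun = y-set , graph , total
        where
        graph : ∀ z → z ∈ y → Σ T λ n → Σ T λ w → z ≡ ⟨ n , w ⟩ × n ∈ N × _
        graph z h with proj₁ (proj₂ x-fun) z (y⊆x z h)
        ... | n , w , refl , n∈M , _ = n , w , refl , ∈N n∈M (∈y⇒P h) , tt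
        total : ∀ n → n ∈ N → Σ T λ w → ⟨ n , w ⟩ ∈ y × (∀ w' → ⟨ n , w' ⟩ ∈ y → w' ≡ w)
        total n n∈N with proj₂ (proj₂ x-fun) n (proj₁ (∈N⁻ n∈N))
        ... | w , nw , unique = w , ∈y nw (proj₂ (∈N⁻ n∈N)) , λ w' h → unique w' (y⊆x _ h)

      composite-y⇒x : ∀ {g t} → IsComposite g y t → IsComposite g x t
      composite-y⇒x comp k m km w kw = y⊆x _ (comp k m km w kw)

      restrict : ∀ 𝓡 code → FamRubricClause 𝓡 code M x → StepClosed 𝓡 code P →
        FamRubricClause 𝓡 code N y
      restrict 𝓡 code clause step i hi g g∈N t ht comp p v pv
        with clause i hi g (weaken (λ _ → proj₁ ∘ ∈N⁻) g∈N) t ht (composite-y⇒x comp) p v pv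
      ... | c∈M , cv∈x = ∈N c∈M Pc , ∈y cv∈x Pc
        where
        Pc : P (code i g p)
        Pc = step i hi g (weaken (λ _ → ∈N⁻) g∈N) t ht (composite-y⇒x comp) p v pv cv∈x

    induction : (P : T → Set) → StepClosed B₀ Basic P →
      (∀ m → m ∈ M → P m → ∀ xm → ⟨ m , xm ⟩ ∈ x → StepClosed (B₁ xm tt) (Trigger m) P) →
      ∀ m → m ∈ M → P m
    induction P basic trigger m m∈M = proj₂ (∈N⁻ (proj₁ (x-least N y N-set y-fun y-ind) m m∈M))
      where
      open Restriction P
      y-ind : FamInductive 𝓑 N y
      y-ind = restrict B₀ Basic (proj₁ x-inductive) basic ,
        λ m m∈N xm mxm∈y → let (m∈M , Pm) = ∈N⁻ m∈N ; mxm∈x = y⊆x _ mxm∈y in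
          restrict (B₁ xm tt) (Trigger m) (proj₂ x-inductive m m∈M xm mxm∈x)
                   (trigger m m∈M Pm xm mxm∈x)

  record AbstractSignature : Set where
    field
      I : T → T
      I-set : ∀ x → isSet (I x)
      K : (x i : T) → i ∈ I x → T
      K-set : ∀ x i h → isSet (K x i h)
      K-irrelevant : ∀ {x i} (h h' : i ∈ I x) → K x i h ≡ K x i h'
      build : T → T → T → T
      build-injective : ∀ {x x' i i' a a'} → i ∈ I x → i' ∈ I x' →
        build x i a ≡ build x' i' a' → x ≡ x' × i ≡ i' × a ≡ a'
      build≢∅ : ∀ x i a → ¬ (build x i a ≡ ∅)

  module OfSignature (𝓢 : AbstractSignature) where
    open AbstractSignature 𝓢

    Inductive : T → Set
    Inductive X = isSet X × ∅ ∈ X ×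
      (∀ x → x ∈ X → ∀ i (h : i ∈ I x) a → IsFun (K x i h) (_∈ X) a → build x i a ∈ X)

    HasLeastInductive : Set
    HasLeastInductive = Σ T λ X → Inductive X × (∀ Y → Inductive Y → X ⊆ Y)

    startRule : Rule 𝔗
    startRule = record
      { K = ∅ ; K-set = ∅-isSet ; R = λ _ _ → single ∅ ; R-fam = λ _ _ → single-isFamily ∅ }

    buildRule : (x i : T) → i ∈ I x → Rule 𝔗
    buildRule x i h = record
      { K = K x i h ; K-set = K-set x i h
      ; R = λ a _ → single (build x i a) ; R-fam = λ a _ → single-isFamily (build x i a) }

    broadRubric : BroadRubric 𝔗
    broadRubric = record
      { B₀ = record { I = sing ∅ ; I-set = upair-isSet ∅ ∅ ; rule = λ _ _ → startRule }
      ; B₁ = λ x _ → record { I = I x ; I-set = I-set x ; rule = buildRule x } }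

    broadSetGeneration⇒least : BroadSetGeneration → HasLeastInductive
    broadSetGeneration⇒least generation with generation broadRubric
    ... | X , (X-set , _) , (start , step) , least = X , X-ind , X-least
      where
      X-ind : Inductive X
      X-ind = X-set , start ∅ (∈-upairˡ ∅ ∅) ∅ ∅-IsFun ∅ ∅ (∈-single ∅) ,
        λ x x∈X i h a ha → step x x∈X i h a ha ∅ (build x i a) (∈-single _)
      X-least : ∀ Y → Inductive Y → X ⊆ Y
      X-least Y (Y-set , ∅∈Y , build∈Y) = least Y (Y-set , λ _ _ → tt)
        ( (λ _ _ _ _ _ v pv → subst (_∈ Y) (sym (proj₂ (∈-single⁻ pv))) ∅∈Y)
        , (λ x x∈Y i h a ha _ v pv →
             subst (_∈ Y) (sym (proj₂ (∈-single⁻ pv))) (build∈Y x x∈Y i h a ha)))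

    module FromLeastFamily (generated : GeneratesFamily broadRubric) where
      open LeastFamily broadRubric generated

      data Origin (m v : T) : Set where
        start : m ≡ Basic ∅ ∅ ∅ → v ≡ ∅ → Origin m v
        built : ∀ m' xm' i (h : i ∈ I xm') g t → m ≡ Trigger m' i g ∅ → ⟨ m' , xm' ⟩ ∈ x →
          IsFun (K xm' i h) (_∈ M) g → IsComposite g x t → v ≡ build xm' i t → Origin m v

      origin : ∀ {m v} → ⟨ m , v ⟩ ∈ x → Origin m v
      origin mv∈x = induction OriginOfValues basic trigger _ (proj₁ (graph⁻ x-fun mv∈x)) _ mv∈x
        where
        OriginOfValues : T → Set
        OriginOfValues m = ∀ v → ⟨ m , v ⟩ ∈ x → Origin m v
        basic : StepClosed B₀ Basic OriginOfValues
        basic i hi g g∈M _ _ _ p v pv cv∈x v' cv'∈x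
          with ∈-sing⁻ hi | IsFun-∅⇒≡∅ g∈M | ∈-single⁻ pv
        ... | refl | refl | refl , refl = start refl (graph-functional x-fun cv'∈x cv∈x)
        trigger : ∀ m → m ∈ M → OriginOfValues m → ∀ xm → ⟨ m , xm ⟩ ∈ x →
          StepClosed (B₁ xm tt) (Trigger m) OriginOfValues
        trigger m _ _ xm mxm∈x i h g g∈M t _ comp p v pv cv∈x v' cv'∈x with ∈-single⁻ pv
        ... | refl , refl = built m xm i h g t refl mxm∈x (weaken (λ _ → proj₁) g∈M) comp
                              (graph-functional x-fun cv'∈x cv∈x)

      IndexOfValues : T → Set
      IndexOfValues m = ∀ n v → ⟨ m , v ⟩ ∈ x → ⟨ n , v ⟩ ∈ x → m ≡ n

      indices-unique : ∀ {D g g' t} →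
        IsFun D (λ n → n ∈ M × IndexOfValues n) g → IsFun D (_∈ M) g' →
        IsFun D 𝔗 t → IsComposite g x t → IsComposite g' x t → g ≡ g'
      indices-unique hg@(_ , g-graph , _) hg' ht comp comp' = IsFun-⊆⇒≡ hg hg' g⊆g'
        where
        g⊆g' : _ ⊆ _
        g⊆g' z z∈g with g-graph z z∈g
        ... | k , n , refl , k∈D , (_ , n-index) with graph-total ht k∈D | graph-total hg' k∈D
        ...   | w , kw∈t | n' , kn'∈g'
          with n-index n' w (comp k n z∈g w kw∈t) (comp' k n' kn'∈g' w kw∈t)
        ...     | refl = kn'∈g'

      x-injective : ∀ {m n v} → ⟨ m , v ⟩ ∈ x → ⟨ n , v ⟩ ∈ x → m ≡ n
      x-injective mv∈x =
        induction IndexOfValues basic trigger _ (proj₁ (graph⁻ x-fun mv∈x)) _ _ mv∈x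
        where
        basic : StepClosed B₀ Basic IndexOfValues
        basic i hi g g∈M _ _ _ p v pv cv∈x n v' cv'∈x nv'∈x with origin nv'∈x
        ... | start refl _ with ∈-sing⁻ hi | IsFun-∅⇒≡∅ g∈M | ∈-single⁻ pv
        ...   | refl | refl | refl , _ = refl
        basic i hi g g∈M _ _ _ p v pv cv∈x n v' cv'∈x nv'∈x | built _ _ _ _ _ _ _ _ _ _ v'≡build =
          ⊥-elim (build≢∅ _ _ _ (trans (sym v'≡build)
            (trans (graph-functional x-fun cv'∈x cv∈x) (proj₂ (∈-single⁻ pv)))))
        trigger : ∀ m → m ∈ M → IndexOfValues m → ∀ xm → ⟨ m , xm ⟩ ∈ x →
          StepClosed (B₁ xm tt) (Trigger m) IndexOfValues
        trigger m _ m-index xm mxm∈x i h g g∈M t ht comp p v pv cv∈x n v' cv'∈x nv'∈x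
          with ∈-single⁻ pv | origin nv'∈x
        ... | refl , refl | start _ v'≡∅ =
          ⊥-elim (build≢∅ _ _ _ (trans (graph-functional x-fun cv∈x cv'∈x) v'≡∅))
        ... | refl , refl | built m' xm' i' h' g' t' refl m'xm'∈x g'∈M comp' v'≡build
          with build-injective h h' (trans (graph-functional x-fun cv∈x cv'∈x) v'≡build)
        ...   | refl , refl , refl with m-index m' xm mxm∈x m'xm'∈x
        ...     | refl = cong (λ g → Trigger m i g ∅)
                  (indices-unique g∈M (subst (λ D → IsFun D (_∈ M) g') (K-irrelevant h' h) g'∈M)
                                  ht comp comp')

      X : T
      X = proj₁ (range M-set x-fun)

      ∈X⇔ : ∀ v → (v ∈ X) ⇔ (Σ T λ m → ⟨ m , v ⟩ ∈ x)
      ∈X⇔ = proj₂ (proj₂ (range M-set x-fun))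

      X-inductive : Inductive X
      X-inductive = proj₁ (proj₂ (range M-set x-fun)) , ∅∈X , build∈X
        where
        ∅∈X : ∅ ∈ X
        ∅∈X = from (∈X⇔ ∅) (_ , proj₂ (proj₁ x-inductive ∅ (∈-upairˡ ∅ ∅) ∅ ∅-IsFun ∅ ∅-IsFun
                                  (λ _ _ k∈∅ → ⊥-elim (∅-empty _ k∈∅)) ∅ ∅ (∈-single ∅)))
        build∈X : ∀ x₀ → x₀ ∈ X → ∀ i (h : i ∈ I x₀) a →
          IsFun (K x₀ i h) (_∈ X) a → build x₀ i a ∈ X
        build∈X x₀ x₀∈X i h a a∈X =
          let (m₀ , m₀x₀∈x) = to (∈X⇔ x₀) x₀∈X
              (g , g∈M , comp) = pullback x-fun x-injective (weaken (λ v → to (∈X⇔ v)) a∈X)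
          in from (∈X⇔ _) (_ , proj₂ (proj₂ x-inductive m₀ (proj₁ (graph⁻ x-fun m₀x₀∈x)) x₀ m₀x₀∈x
                                   i h g g∈M a (weaken _ a∈X) comp ∅ (build x₀ i a) (∈-single _)))

      X-least : ∀ Y → Inductive Y → X ⊆ Y
      X-least Y (_ , ∅∈Y , build∈Y) v v∈X with to (∈X⇔ v) v∈X
      ... | m , mv∈x = induction ValuesIn basic trigger m (proj₁ (graph⁻ x-fun mv∈x)) v mv∈x
        where
        ValuesIn : T → Set
        ValuesIn m = ∀ v → ⟨ m , v ⟩ ∈ x → v ∈ Y
        basic : StepClosed B₀ Basic ValuesIn
        basic _ _ _ _ _ _ _ _ v pv cv∈x v' cv'∈x =
          subst (_∈ Y) (sym (trans (graph-functional x-fun cv'∈x cv∈x) (proj₂ (∈-single⁻ pv)))) ∅∈Y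
        trigger : ∀ m → m ∈ M → ValuesIn m → ∀ xm → ⟨ m , xm ⟩ ∈ x →
          StepClosed (B₁ xm tt) (Trigger m) ValuesIn
        trigger m _ m-in xm mxm∈x i h g g-in t ht comp _ v pv cv∈x v' cv'∈x =
          subst (_∈ Y) (sym (trans (graph-functional x-fun cv'∈x cv∈x) (proj₂ (∈-single⁻ pv))))
            (build∈Y xm (m-in xm mxm∈x) i h t (composite-IsFun g-in ht comp λ (_ , n-in) → n-in _))

    broadFamilyGeneration⇒least : BroadFamilyGeneration → HasLeastInductive
    broadFamilyGeneration⇒least generation =
      X , X-inductive , X-least
      where open FromLeastFamily (generation broadRubric)

  module FromBroadSignature (G : T → T) (G-sig : ∀ x → IsSignature (G x)) where
    J : T → T
    J x = proj₁ (G-sig x)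

    G-fun : ∀ x → IsFun (J x) isSet (G x)
    G-fun x = proj₂ (proj₂ (G-sig x))

    arity : ∀ x i → i ∈ J x → T
    arity x i h = proj₁ (proj₂ (proj₂ (G-fun x)) i h)

    arity∈G : ∀ x i h → ⟨ i , arity x i h ⟩ ∈ G x
    arity∈G x i h = proj₁ (proj₂ (proj₂ (proj₂ (G-fun x)) i h))

    signature : AbstractSignature
    signature = record
      { I = J
      ; I-set = λ x → proj₁ (proj₂ (G-sig x))
      ; K = arity
      ; K-set = λ x i h → proj₂ (graph⁻ (G-fun x) (arity∈G x i h))
      ; K-irrelevant = λ {x} h h' → graph-functional (G-fun x) (arity∈G x _ h) (arity∈G x _ h')
      ; build = Build
      ; build-injective = λ _ _ e →
          let (e₁ , e₂) = pair-injective e ; (e₃ , e₄) = pair-injective e₂ in e₁ , e₃ , e₄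
      ; build≢∅ = λ _ _ _ → pair≢∅ }

    open OfSignature signature using (Inductive; HasLeastInductive)

    Inductive⇔GInductive : ∀ Y → Inductive Y ⇔ GInductive G Y
    Inductive⇔GInductive Y = mk⇔
      (λ (Y-set , ∅∈Y , build∈Y) → Y-set , ∅∈Y , λ x x∈Y i Ki iKi a a∈Y →
        let h = proj₁ (graph⁻ (G-fun x) iKi) in
        build∈Y x x∈Y i h a
          (subst (λ D → IsFun D (_∈ Y) a) (graph-functional (G-fun x) iKi (arity∈G x i h)) a∈Y))
      (λ (Y-set , ∅∈Y , Build∈Y) → Y-set , ∅∈Y , λ x x∈Y i h → Build∈Y x x∈Y i _ (arity∈G x i h))

    broadInfinity : HasLeastInductive →
      Σ T λ X → GInductive G X × (∀ Y → GInductive G Y → X ⊆ Y)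
    broadInfinity (X , X-ind , least) =
      X , to (Inductive⇔GInductive X) X-ind , λ Y → least Y ∘ from (Inductive⇔GInductive Y)

  module FromReducedSignature (F : T → T) (F-set : ∀ x → isSet (F x)) where
    signature : AbstractSignature
    signature = record
      { I = λ _ → sing ∅
      ; I-set = λ _ → upair-isSet ∅ ∅
      ; K = λ x _ _ → F x
      ; K-set = λ x _ _ → F-set x
      ; K-irrelevant = λ _ _ → refl
      ; build = λ x _ a → Make x a
      ; build-injective = λ h h' e →
          proj₁ (pair-injective e) , trans (∈-sing⁻ h) (sym (∈-sing⁻ h')) , proj₂ (pair-injective e)
      ; build≢∅ = λ _ _ _ → pair≢∅ }

    open OfSignature signature using (Inductive; HasLeastInductive)

    Inductive⇔FInductive : ∀ Y → Inductive Y ⇔ FInductive F Y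
    Inductive⇔FInductive Y = mk⇔
      (λ (Y-set , ∅∈Y , build∈Y) → Y-set , ∅∈Y , λ x x∈Y → build∈Y x x∈Y ∅ (∈-upairˡ ∅ ∅))
      (λ (Y-set , ∅∈Y , Make∈Y) → Y-set , ∅∈Y , λ x x∈Y _ _ → Make∈Y x x∈Y)

    reducedBroadInfinity : HasLeastInductive →
      Σ T λ X → FInductive F X × (∀ Y → FInductive F Y → X ⊆ Y)
    reducedBroadInfinity (X , X-ind , least) =
      X , to (Inductive⇔FInductive X) X-ind , λ Y → least Y ∘ from (Inductive⇔FInductive Y)

  least⇒infinities : (∀ 𝓢 → OfSignature.HasLeastInductive 𝓢) → BroadInfinity × ReducedBroadInfinity
  least⇒infinities least =
    (λ G G-sig → let open FromBroadSignature G G-sig in broadInfinity (least signature)) ,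
    (λ F F-set → let open FromReducedSignature F F-set in reducedBroadInfinity (least signature))

proposition6p1 : (M : BaseTheory) → let open Notions M in
    ((C : Class) → ((𝓑 : BroadRubric C) → GeneratesB 𝓑) → (𝓡 : Rubric C) → Generates 𝓡)
    × (BroadSetGeneration → BroadInfinity × ReducedBroadInfinity)
    × (BroadFamilyGeneration → BroadInfinity × ReducedBroadInfinity)
proposition6p1 M =
  (λ _ → generatesB⇒generates) ,
  (λ generation → least⇒infinities λ 𝓢 → OfSignature.broadSetGeneration⇒least 𝓢 generation) ,
  (λ generation → least⇒infinities λ 𝓢 → OfSignature.broadFamilyGeneration⇒least 𝓢 generation)
  where open Model M
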